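{- If a predicate structure $\mathfrak P$ is comprehensive, then its birelational collapse $\mathfrak P^B$ is comprehensive.
   Context: Formulas: $A ::= P \mid X \mid A\to B \mid \Box A \mid \blacksquare A \mid \forall X A$ over propositional symbols $P\in\mathsf{Pr}$ and second-order variables $X$; closed = no free variables; $A[C/X]$ capture-avoiding substitution. A predicate structure $\mathfrak P$: a set $\Omega$ of states with partial order $\le$; a set $W$ of modal worlds; a set $\mathcal W\supseteq\mathsf{Pr}$ of sets; for each $V\in\mathcal W$, $a\in\Omega$, a set $V^a\subseteq W$, monotone in $a$; for each $a$ a relation $R^a\subseteq W\times W$, monotone in $a$. Expanding the language by each $V\in\mathcal W$ as a symbol: $a,v\models P$ iff $v\in P^a$; $a,v\models A\to B$ iff $\forall b\ge a$ ($b,v\models A\Rightarrow b,v\models B$); $a,v\models\Box A$ iff $\forall b\ge a\,\forall w$ ($vR^bw\Rightarrow b,w\models A$); $a,v\models\blacksquare A$ iff $\forall b\ge a\,\forall u$ ($uR^bv\Rightarrow b,u\models A$); $a,v\models\forall XA$ iff $\forall b\ge a\,\forall V\in\mathcal W$, $b,v\models A[V/X]$. $\mathfrak P$ is comprehensive if for each closed formula $C$ of the expanded language there is $[C]\in\mathcal W$ with $[C]^a=\{w: a,w\models C\}$ for all $a$. A birelational structure: worlds with partial order $\le$, a class $\mathcal W'$ of upward-closed sets of worlds, an interpretation of each $P\in\mathsf{Pr}$ in $\mathcal W'$, relation $R$; satisfaction (each $V\in\mathcal W'$ added as a symbol interpreted as $V$): $v\models P$ iff $v\in P$'s interpretation;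 $v\models A\to B$ iff $\forall v'\ge v$ ($v'\models A\Rightarrow v'\models B$); $v\models\Box A$ iff $\forall v'\ge v\,\forall w'$ ($v'Rw'\Rightarrow w'\models A$); $v\models\blacksquare A$ iff $\forall v'\ge v\,\forall u'$ ($u'Rv'\Rightarrow u'\models A$); $v\models\forall XA$ iff $\forall v'\ge v\,\forall V\in\mathcal W'$, $v'\models A[V/X]$. It is comprehensive if $\{w:w\models C\}\in\mathcal W'$ for every closed $C$ of its expanded language. The birelational collapse $\mathfrak P^B$: worlds $\Omega\times W$; $(a,v)\le(b,w)$ iff $a\le b$, $v=w$; sets $V^B=\{(a,v):v\in V^a\}$ for $V\in\mathcal W$; $P\in\mathsf{Pr}$ interpreted as $P^B$; $(a,v)R(b,w)$ iff $a=b$ and $vR^aw$. -}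

module Defs where

open import Data.Nat using (ℕ; zero; suc)
open import Data.Fin using (Fin; zero; suc)
open import Data.Sum using (_⊎_; inj₁; inj₂; map₂)
open import Data.Product using (Σ; _×_; _,_; proj₁; proj₂)
open import Function.Bundles using (_⇔_)
open import Relation.Binary.Core using (Rel)
open import Relation.Binary.Structures using (IsPartialOrder; IsPreorder)
open import Relation.Binary.PropositionalEquality
  using (_≡_; refl; isEquivalence; cong₂; subst)

-- Formulas over a type K of constant symbols (propositional symbols and
-- the added set-symbols), with second-order variables as well-scoped
-- de Bruijn indices: Form K n = formulas with at most n free variables.
-- A formula is closed iff it lives in Form K 0.

infixr 5 _⇒_

data Form (K : Set) (n : ℕ) : Set where
  con  : K → Form K n
  var  : Fin n → Form K n
  _⇒_  : Form K n → Form K n → Form K n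
  □    : Form K n → Form K n
  ■    : Form K n → Form K n
  all  : Form K (suc n) → Form K n

liftσ : ∀ {K : Set} {m n} → (Fin m → K ⊎ Fin n) → Fin (suc m) → K ⊎ Fin (suc n)
liftσ σ zero    = inj₂ zero
liftσ σ (suc i) = map₂ suc (σ i)

sub : ∀ {K : Set} {m n} → (Fin m → K ⊎ Fin n) → Form K m → Form K n
sub σ (con P) = con P
sub σ (var i) with σ i
... | inj₁ V = con V
... | inj₂ j = var j
sub σ (A ⇒ B) = sub σ A ⇒ sub σ B
sub σ (□ A)   = □ (sub σ A)
sub σ (■ A)   = ■ (sub σ A)
sub σ (all A) = all (sub (liftσ σ) A)

single : ∀ {K : Set} {n} → K → Fin (suc n) → K ⊎ Fin n
single V zero    = inj₁ V
single V (suc i) = inj₂ i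

_[_/X] : ∀ {K : Set} {n} → Form K (suc n) → K → Form K n
A [ V /X] = sub (single V) A

Env : Set → ℕ → Set
Env K n = Fin n → K

ext : ∀ {K : Set} {n} → K → Env K n → Env K (suc n)
ext V ρ zero    = V
ext V ρ (suc i) = ρ i

empty : ∀ {K : Set} → Env K 0
empty ()

-- Predicate structures (over a set Pr of propositional symbols).
-- 𝒲 is given as an index type WS with Pr ⊆ 𝒲 via ιPr; V^a ⊆ W is
-- the predicate  ext V a : W → Set.

record PredicateStructure (Pr : Set) : Set₁ where
  field
    Ω      : Set
    _≤_    : Rel Ω _
    ≤-po   : IsPartialOrder _≡_ _≤_
    W      : Set
    WS     : Set
    ιPr    : Pr → WS
    _^_∋_  : WS → Ω → W → Set
    ^-mono : ∀ V {a b} w → a ≤ b → V ^ a ∋ w → V ^ b ∋ w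
    Rel^   : Ω → W → W → Set
    R-mono : ∀ {a b} v w → a ≤ b → Rel^ a v w → Rel^ b v w

module _ {Pr : Set} (𝔓 : PredicateStructure Pr) where
  open PredicateStructure 𝔓

  -- satisfaction for the expanded language (constants = 𝒲), with the
  -- free variables interpreted by an environment; for closed formulas
  -- (n = 0, ρ = empty) this is the paper's relation a,v ⊨ A, the clause
  -- for ∀ being  b,v ⊨ A[V/X]  rendered as  A under ρ extended by V.
  satP : ∀ {n} → Env WS n → Ω → W → Form WS n → Set
  satP ρ a v (con V)  = V ^ a ∋ v
  satP ρ a v (var i)  = ρ i ^ a ∋ v
  satP ρ a v (A ⇒ B)  = ∀ b → a ≤ b → satP ρ b v A → satP ρ b v B
  satP ρ a v (□ A)    = ∀ b → a ≤ b → ∀ w → Rel^ b v w → satP ρ b w A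
  satP ρ a v (■ A)    = ∀ b → a ≤ b → ∀ u → Rel^ b u v → satP ρ b u A
  satP ρ a v (all A)  = ∀ b → a ≤ b → ∀ V → satP (ext V ρ) b v A

  _,_⊨P_ : Ω → W → Form WS 0 → Set
  a , v ⊨P C = satP empty a v C

  ComprehensiveP : Set
  ComprehensiveP =
    (C : Form WS 0) → Σ WS λ V → ∀ a w → (V ^ a ∋ w) ⇔ (a , w ⊨P C)

-- Birelational structures. 𝒲' is given as an index type WS with an
-- interpretation ⟦_⟧ as upward-closed sets of worlds.

record BirelationalStructure (Pr : Set) : Set₁ where
  field
    Wd      : Set
    _≤_     : Rel Wd _
    ≤-po    : IsPartialOrder _≡_ _≤_
    WS      : Set
    ⟦_⟧∋_   : WS → Wd → Set
    upward  : ∀ V {x y} → x ≤ y → ⟦ V ⟧∋ x → ⟦ V ⟧∋ y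
    intPr   : Pr → WS
    R       : Wd → Wd → Set

module _ {Pr : Set} (𝔅 : BirelationalStructure Pr) where
  open BirelationalStructure 𝔅

  Sym : Set
  Sym = Pr ⊎ WS

  symInt : Sym → WS
  symInt (inj₁ P) = intPr P
  symInt (inj₂ V) = V

  satB : ∀ {n} → Env WS n → Wd → Form Sym n → Set
  satB ρ v (con S)  = ⟦ symInt S ⟧∋ v
  satB ρ v (var i)  = ⟦ ρ i ⟧∋ v
  satB ρ v (A ⇒ B)  = ∀ v' → v ≤ v' → satB ρ v' A → satB ρ v' B
  satB ρ v (□ A)    = ∀ v' → v ≤ v' → ∀ w' → R v' w' → satB ρ w' A
  satB ρ v (■ A)    = ∀ v' → v ≤ v' → ∀ u' → R u' v' → satB ρ u' A
  satB ρ v (all A)  = ∀ v' → v ≤ v' → ∀ V → satB (ext V ρ) v' A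

  _⊨B_ : Wd → Form Sym 0 → Set
  v ⊨B C = satB empty v C

  ComprehensiveB : Set
  ComprehensiveB =
    (C : Form Sym 0) → Σ WS λ V → ∀ x → (⟦ V ⟧∋ x) ⇔ (x ⊨B C)

module _ {Pr : Set} (𝔓 : PredicateStructure Pr) where
  open PredicateStructure 𝔓

  _≤B_ : Rel (Ω × W) _
  (a , v) ≤B (b , w) = (a ≤ b) × (v ≡ w)

  private
    module PO = IsPartialOrder ≤-po

  ≤B-po : IsPartialOrder _≡_ _≤B_
  ≤B-po = record
    { isPreorder = record
      { isEquivalence = isEquivalence
      ; reflexive = λ { refl → PO.reflexive refl , refl }
      ; trans = λ { (p , refl) (q , refl) → PO.trans p q , refl }
      }
    ; antisym = λ { (p , refl) (q , _) → cong₂ _,_ (PO.antisym p q) refl }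
    }

  collapse : BirelationalStructure Pr
  collapse = record
    { Wd     = Ω × W
    ; _≤_    = _≤B_
    ; ≤-po   = ≤B-po
    ; WS     = PredicateStructure.WS 𝔓           -- 𝒲' = { V^B : V ∈ 𝒲 }
    ; ⟦_⟧∋_  = λ V x → V ^ proj₁ x ∋ proj₂ x
    ; upward = λ { V {a , v} (p , refl) h → ^-mono V v p h }
    ; intPr  = ιPr
    ; R      = λ x y → (proj₁ x ≡ proj₁ y) × Rel^ (proj₁ x) (proj₂ x) (proj₂ y)
    }

module Submission where

-- A world (a , v) of the collapse satisfies A exactly when a , v ⊨ A:
-- the ≤-successors of (a , v) are the (b , v) with a ≤ b, and its
-- R-neighbours are the (b , w) related to v by R^b. Hence the set [C]
-- given by comprehensiveness of 𝔓 also names C in the collapse.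

open import Defs
open import Data.Product using (_,_)
open import Function.Bundles using (_⇔_; mk⇔)
open import Function.Properties.Equivalence using (trans)
open import Relation.Binary.PropositionalEquality using (refl)

relabel : ∀ {K L : Set} {n} → (K → L) → Form K n → Form L n
relabel f (con k) = con (f k)
relabel f (var i) = var i
relabel f (A ⇒ B) = relabel f A ⇒ relabel f B
relabel f (□ A)   = □ (relabel f A)
relabel f (■ A)   = ■ (relabel f A)
relabel f (all A) = all (relabel f A)

module _ {Pr : Set} (𝔓 : PredicateStructure Pr) where
  open PredicateStructure 𝔓

  private
    𝔅 : BirelationalStructure Pr
    𝔅 = collapse 𝔓

  toP : ∀ {n} → Form (Sym 𝔅) n → Form WS n
  toP = relabel (symInt 𝔅)

  satB-collapse⇒satP : ∀ {n} (ρ : Env WS n) a v (A : Form (Sym 𝔅) n) →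
                       satB 𝔅 ρ (a , v) A → satP 𝔓 ρ a v (toP A)
  satP⇒satB-collapse : ∀ {n} (ρ : Env WS n) a v (A : Form (Sym 𝔅) n) →
                       satP 𝔓 ρ a v (toP A) → satB 𝔅 ρ (a , v) A

  satB-collapse⇒satP ρ a v (con s) h = h
  satB-collapse⇒satP ρ a v (var i) h = h
  satB-collapse⇒satP ρ a v (A ⇒ B) h b a≤b hA =
    satB-collapse⇒satP ρ b v B (h (b , v) (a≤b , refl) (satP⇒satB-collapse ρ b v A hA))
  satB-collapse⇒satP ρ a v (□ A) h b a≤b w vRw =
    satB-collapse⇒satP ρ b w A (h (b , v) (a≤b , refl) (b , w) (refl , vRw))
  satB-collapse⇒satP ρ a v (■ A) h b a≤b u uRv =
    satB-collapse⇒satP ρ b u A (h (b , v) (a≤b , refl) (b , u) (refl , uRv))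
  satB-collapse⇒satP ρ a v (all A) h b a≤b V =
    satB-collapse⇒satP (ext V ρ) b v A (h (b , v) (a≤b , refl) V)

  satP⇒satB-collapse ρ a v (con s) h = h
  satP⇒satB-collapse ρ a v (var i) h = h
  satP⇒satB-collapse ρ a v (A ⇒ B) h (b , .v) (a≤b , refl) hA =
    satP⇒satB-collapse ρ b v B (h b a≤b (satB-collapse⇒satP ρ b v A hA))
  satP⇒satB-collapse ρ a v (□ A) h (b , .v) (a≤b , refl) (.b , w) (refl , vRw) =
    satP⇒satB-collapse ρ b w A (h b a≤b w vRw)
  satP⇒satB-collapse ρ a v (■ A) h (b , .v) (a≤b , refl) (.b , u) (refl , uRv) =
    satP⇒satB-collapse ρ b u A (h b a≤b u uRv)
  satP⇒satB-collapse ρ a v (all A) h (b , .v) (a≤b , refl) V =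
    satP⇒satB-collapse (ext V ρ) b v A (h b a≤b V)

  ⊨P⇔⊨B-collapse : ∀ a v (C : Form (Sym 𝔅) 0) → _,_⊨P_ 𝔓 a v (toP C) ⇔ _⊨B_ 𝔅 (a , v) C
  ⊨P⇔⊨B-collapse a v C = mk⇔ (satP⇒satB-collapse empty a v C) (satB-collapse⇒satP empty a v C)

corollary3p9 : {Pr : Set} (𝔓 : PredicateStructure Pr) → ComprehensiveP 𝔓 → ComprehensiveB (collapse 𝔓)
corollary3p9 𝔓 comp C with comp (toP 𝔓 C)
... | [C] , [C]-spec = [C] , λ { (a , w) →
        trans ([C]-spec a w) (⊨P⇔⊨B-collapse 𝔓 a w C) }
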